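{- For every graph $G$ and any positive integers $k$ and $s$, we have $c_{s,s}(G)\ge c_{ks,ks}(G)$.
   Context: All graphs are finite, undirected and reflexive. For a positive integer $t$, in the speed-$(t,t)$ Cops and Robbers game on a graph $G$, the cops first place themselves on vertices, then the robber places himself; play proceeds in rounds, each a cops' turn followed by a robber's turn. On the cops' turn each cop moves along a walk of length at most $t$ (possibly staying put); on the robber's turn he moves along a walk of length at most $t$ not passing through a cop-occupied vertex. The cops win if some cop occupies the robber's vertex; the robber wins if he evades forever. $c_{t,t}(G)$ is the minimum number of cops guaranteeing a win. -}

module Defs where

open import Data.Nat using (ℕ; zero; suc; _≤_)
open import Data.Fin using (Fin)
open import Data.Product using (Σ; ∃; _×_)
open import Data.Sum using (_⊎_)
open import Relation.Nullary using (¬_)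
open import Relation.Binary.PropositionalEquality using (_≡_)

record Graph : Set₁ where
  field
    n       : ℕ
    Adj     : Fin n → Fin n → Set
    adj-refl : ∀ v → Adj v v
    adj-sym  : ∀ {u v} → Adj u v → Adj v u

module _ (G : Graph) where
  open Graph G

  V : Set
  V = Fin n

  data Walk : ℕ → V → V → Set where
    stay : ∀ {t u} → Walk t u u
    step : ∀ {t u w v} → Adj u w → Walk t w v → Walk (suc t) u v

  Cops : ℕ → Set
  Cops m = Fin m → V

  Occupied : ∀ {m} → Cops m → V → Set
  Occupied cs v = ∃ λ i → cs i ≡ v

  -- AvoidWalk cs t u v : walk from u to v of length at most t, no vertex
  -- entered along the walk (including v) is cop-occupied.  (The start u is
  -- the robber's current, uncaught, vertex.)
  data AvoidWalk {m : ℕ} (cs : Cops m) : ℕ → V → V → Set where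
    stay : ∀ {t u} → AvoidWalk cs t u u
    step : ∀ {t u w v} → Adj u w → ¬ Occupied cs w →
           AvoidWalk cs t w v → AvoidWalk cs (suc t) u v

  -- Win t cs r : in the speed-(t,t) game, it is the cops' turn, the cops are
  -- at cs, the robber is at r (not captured); the cops can force a capture
  -- in finitely many rounds.
  data Win (t : ℕ) {m : ℕ} (cs : Cops m) (r : V) : Set where
    move : (cs' : Cops m) → (∀ i → Walk t (cs i) (cs' i)) →
           (Occupied cs' r ⊎ (∀ r' → AvoidWalk cs' t r r' → Win t cs' r')) →
           Win t cs r

  CopsWin : ℕ → ℕ → Set
  CopsWin t m = Σ (Cops m) λ cs → ∀ r → Occupied cs r ⊎ Win t cs r

  IsCopNumber : ℕ → ℕ → Set
  IsCopNumber t c = CopsWin t c × (∀ m → CopsWin t m → c ≤ m)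

-- A team of cops that wins at speed s also wins at speed (k+1)s by running its
-- speed-s strategy k+1 rounds per turn, one turn behind the robber. A robber
-- move of length (k+1)s is cut into k+1 pieces of length s; the first is a
-- legal speed-s move against the cops' current position, the other k are
-- replayed as speed-s robber moves during the cops' next turn, which ends with
-- one fresh move of the strategy. Should a replayed piece run into a cop, that
-- cop follows the rest of the robber's path, which fits in the turn's budget.
module Submission where

open import Defs
open import Data.Nat using (ℕ; zero; suc; _+_; _*_; _≤_; z≤n; s≤s)
open import Data.Nat.Properties using (≤-refl; +-monoʳ-≤; m≤n+m; m+n≤o⇒m≤o; +-assoc; +-identityʳ)
open import Data.Fin.Properties using (_≟_; any?)
open import Data.Vec.Functional using (updateAt)
open import Data.Vec.Functional.Properties using (updateAt-updates; updateAt-minimal)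
open import Data.Product using (∃; _×_; _,_)
open import Data.Sum using (_⊎_; inj₁; inj₂; map₂)
open import Function using (const)
open import Relation.Nullary using (Dec; yes; no)
open import Relation.Binary.PropositionalEquality using (_≡_; refl; sym; subst)

module _ (G : Graph) where
  open Graph G

  Walk-mono : ∀ {t t′ u v} → t ≤ t′ → Walk G t u v → Walk G t′ u v
  Walk-mono _          stay       = stay
  Walk-mono (s≤s t≤t′) (step e w) = step e (Walk-mono t≤t′ w)

  _++_ : ∀ {a b u v w} → Walk G a u v → Walk G b v w → Walk G (a + b) u w
  _++_ {a} stay q = Walk-mono (m≤n+m _ a) q
  step e p ++ q   = step e (p ++ q)

  Walk-0⇒≡ : ∀ {u v} → Walk G 0 u v → u ≡ v
  Walk-0⇒≡ stay = refl

  Walk-split : ∀ a b {u v} → Walk G (a + b) u v → ∃ λ m → Walk G a u m × Walk G b m v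
  Walk-split zero    b {u} w          = u , stay , w
  Walk-split (suc a) b {u} stay       = u , stay , stay
  Walk-split (suc a) b     (step e w) with Walk-split a b w
  ... | m , p , q = m , step e p , q

  AvoidWalk⇒Walk : ∀ {m} {cs : Cops G m} {t u v} → AvoidWalk G cs t u v → Walk G t u v
  AvoidWalk⇒Walk stay         = stay
  AvoidWalk⇒Walk (step e _ w) = step e (AvoidWalk⇒Walk w)

  AvoidWalk-split : ∀ {m} {cs : Cops G m} a b {u v} → AvoidWalk G cs (a + b) u v →
                    ∃ λ x → AvoidWalk G cs a u x × Walk G b x v
  AvoidWalk-split zero    b {u} w             = u , stay , AvoidWalk⇒Walk w
  AvoidWalk-split (suc a) b {u} stay          = u , stay , stay
  AvoidWalk-split (suc a) b     (step e ¬o w) with AvoidWalk-split a b w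
  ... | x , p , q = x , step e ¬o p , q

  Occupied? : ∀ {m} (cs : Cops G m) v → Dec (Occupied G cs v)
  Occupied? cs v = any? (λ i → cs i ≟ v)

  avoid-or-reach : ∀ {m} (cs : Cops G m) {t u v} → Walk G t u v →
                   AvoidWalk G cs t u v ⊎ ∃ λ i → Walk G t (cs i) v
  avoid-or-reach cs stay = inj₁ stay
  avoid-or-reach cs (step {w = w} e p) with Occupied? cs w
  ... | yes (i , refl) = inj₂ (i , Walk-mono (m≤n+m _ 1) p)
  ... | no ¬o with avoid-or-reach cs p
  ...   | inj₁ avoiding     = inj₁ (step e ¬o avoiding)
  ...   | inj₂ (i , reach) = inj₂ (i , Walk-mono (m≤n+m _ 1) reach)

  CopsMove : ∀ {m} → ℕ → Cops G m → Cops G m → Set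
  CopsMove t C D = ∀ i → Walk G t (C i) (D i)

  CopsMove-mono : ∀ {m t t′} {C D : Cops G m} → t ≤ t′ → CopsMove t C D → CopsMove t′ C D
  CopsMove-mono t≤t′ C→D i = Walk-mono t≤t′ (C→D i)

  _⨾_ : ∀ {m a b} {C D E : Cops G m} → CopsMove a C D → CopsMove b D E → CopsMove (a + b) C E
  (C→D ⨾ D→E) i = C→D i ++ D→E i

  win-by-capture : ∀ {m t u K} {C D : Cops G m} {x} i → t + u ≤ K →
                   CopsMove t C D → Walk G u (D i) x → Win G K C x
  win-by-capture {t = t} {K = K} {C} {D} {x} i budget C→D Di→x =
    move D′ C→D′ (inj₁ (i , updateAt-updates i D))
    where
    D′ : Cops G _
    D′ = updateAt D i (const x)
    C→D′ : CopsMove K C D′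
    C→D′ l with l ≟ i
    ... | yes refl = subst (Walk G K (C i)) (sym (updateAt-updates i D))
                           (Walk-mono budget (C→D i ++ Di→x))
    ... | no l≢i   = subst (Walk G K (C l)) (sym (updateAt-minimal l i D l≢i))
                           (CopsMove-mono (m+n≤o⇒m≤o t budget) C→D l)

  module _ (s k : ℕ) where

    -- The cops of the speed-(k+1)s game have spent a steps of their turn to
    -- reach C, where the speed-s strategy stands against a robber at r; the
    -- robber's path from r to x consists of j pieces not yet replayed.
    win-lagging : ∀ {m} j a {C₀ C : Cops G m} {r x} → a + suc j * s ≤ suc k * s →
                  CopsMove a C₀ C → Win G s C r → Walk G (j * s) r x → Win G (suc k * s) C₀ x
    win-lagging zero a budget C₀→C (move C₁ C→C₁ result) r→x
      with Walk-0⇒≡ r→x | subst (λ n → a + n ≤ suc k * s) (+-identityʳ s) budget | result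
    ... | refl | budget′ | inj₁ caught = move C₁ (CopsMove-mono budget′ (C₀→C ⨾ C→C₁)) (inj₁ caught)
    ... | refl | budget′ | inj₂ lose   = move C₁ (CopsMove-mono budget′ (C₀→C ⨾ C→C₁)) (inj₂ next-turn)
      where
      next-turn : ∀ y → AvoidWalk G C₁ (suc k * s) _ y → Win G (suc k * s) C₁ y
      next-turn y path with AvoidWalk-split s (k * s) path
      ... | r₁ , first , rest = win-lagging k 0 ≤-refl (λ _ → stay) (lose r₁ first) rest
    win-lagging (suc j) a budget C₀→C (move C₁ C→C₁ result) r→x
      with subst (_≤ suc k * s) (sym (+-assoc a s (suc j * s))) budget | result
    ... | budget′ | inj₁ (i , refl) = win-by-capture i budget′ (C₀→C ⨾ C→C₁) r→x
    ... | budget′ | inj₂ lose with Walk-split s (j * s) r→x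
    ...   | r₁ , piece , rest with avoid-or-reach C₁ piece
    ...     | inj₁ avoiding     = win-lagging j (a + s) budget′ (C₀→C ⨾ C→C₁) (lose r₁ avoiding) rest
    ...     | inj₂ (i , reach) = win-by-capture i budget′ (C₀→C ⨾ C→C₁) (reach ++ rest)

    CopsWin-speedup : ∀ {m} → CopsWin G s m → CopsWin G (suc k * s) m
    CopsWin-speedup (C , wins) =
      C , λ r → map₂ (λ w → win-lagging 0 0 budget (λ _ → stay) w stay) (wins r)
      where
      budget : 0 + 1 * s ≤ suc k * s
      budget = +-monoʳ-≤ s z≤n

theorem2p8 : (G : Graph) (k s : ℕ) → 1 ≤ k → 1 ≤ s →
    (c₁ c₂ : ℕ) → IsCopNumber G s c₁ → IsCopNumber G (k * s) c₂ → c₂ ≤ c₁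
theorem2p8 G (suc k) s (s≤s z≤n) _ c₁ c₂ (c₁-wins , _) (_ , c₂-minimal) =
  c₂-minimal c₁ (CopsWin-speedup G s k c₁-wins)
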